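{- Let $k\geq1$ and let $\mathcal P(k)$ be the set of partitions of $\{1,\ldots,k\}$. Let $\mathcal D(k)$ be the set consisting of the pair $(I_k,(1,\ldots,k))$, where $I_k$ is the $k\times k$ identity matrix and we set $\nu_i=i$ for $1\leq i\leq k$, together with all pairs $(D,(\nu,\mu))$ where $(\nu,\mu)$ is a division of $\{1,\ldots,k\}$ with $1\leq m\leq k-1$ and $D$ is an $m\times k$ $(\nu,\mu)$-admissible matrix with respect to $q=1$ having all entries in $\{0,1\}$ and exactly one non-zero entry in each column. Then there is a bijection $g:\mathcal D(k)\to\mathcal P(k)$ such that whenever $D$ is an $m\times k$ matrix (with associated $\nu_1,\ldots,\nu_m$) and $g(D)=P=\{B_1,\ldots,B_{\#P}\}$, one has $\#P=m$ and $\{\nu_1,\ldots,\nu_m\}=\{j_{B_1},\ldots,j_{B_m}\}$, where $j_B=\min_{j\in B}j$.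
   Context: A division $(\nu,\mu)=(\nu_1,\ldots,\nu_m;\mu_1,\ldots,\mu_{k-m})$ of $\{1,\ldots,k\}$, with $1\leq m\leq k-1$, is a splitting of $\{1,\ldots,k\}$ into two disjoint increasing sequences $1\leq\nu_1<\cdots<\nu_m\leq k$ and $1\leq\mu_1<\cdots<\mu_{k-m}\leq k$ whose union is $\{1,\ldots,k\}$. For a positive integer $q$, an $m\times k$ integer matrix $D=(d_{ij})$ is $(\nu,\mu)$-admissible (with respect to $q$) if no column vanishes, the gcd of all entries is $1$, $d_{i\nu_j}=q\delta_{ij}$ for $1\leq i,j\leq m$, and $d_{i\mu_j}=0$ whenever $\mu_j<\nu_i$. -}

module Defs where

open import Data.Nat as ℕ using (ℕ; zero; suc; _∸_)
open import Data.Fin as Fin using (Fin; toℕ)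
open import Data.Integer as ℤ using (ℤ; 0ℤ; 1ℤ)
open import Data.Integer.Divisibility using (_∣_)
open import Data.List using (List; length; lookup)
open import Data.List.Membership.Propositional using (_∈_)
open import Data.Fin.Subset using (Subset; Nonempty) renaming (_∈_ to _∈ₛ_)
open import Data.Product using (Σ; ∃; ∃-syntax; _×_; _,_)
open import Data.Sum using (_⊎_)
open import Data.Unit using (⊤)
open import Data.Empty using (⊥)
open import Relation.Nullary using (¬_)
open import Relation.Binary.PropositionalEquality using (_≡_; _≢_)
open import Function.Bundles using (_⇔_)

-- Indices: {1,…,k} is modelled by Fin k (0-based), ordered by Fin's _<_.
-- An m×k integer matrix is a function Fin m → Fin k → ℤ.

Matrix : ℕ → ℕ → Set
Matrix m k = Fin m → Fin k → ℤ

StrictlyIncreasing : ∀ {n k} → (Fin n → Fin k) → Set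
StrictlyIncreasing s = ∀ i j → i Fin.< j → s i Fin.< s j

IsDivision : (k m : ℕ) → (Fin m → Fin k) → (Fin (k ∸ m) → Fin k) → Set
IsDivision k m ν μ =
  StrictlyIncreasing ν × StrictlyIncreasing μ ×
  (∀ i j → ν i ≢ μ j) ×
  (∀ x → (∃[ i ] ν i ≡ x) ⊎ (∃[ j ] μ j ≡ x))

Admissible : (k m : ℕ) (q : ℤ) → (Fin m → Fin k) → (Fin (k ∸ m) → Fin k) →
             Matrix m k → Set
Admissible k m q ν μ D =
  (∀ j → ∃[ i ] D i j ≢ 0ℤ) ×
  -- the gcd of all entries is 1 (every common divisor divides 1)
  (∀ (d : ℤ) → (∀ i j → d ∣ D i j) → d ∣ 1ℤ) ×
  (∀ i j → (i ≡ j → D i (ν j) ≡ q) × (i ≢ j → D i (ν j) ≡ 0ℤ)) ×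
  (∀ i j → μ j Fin.< ν i → D i (μ j) ≡ 0ℤ)

ZeroOne : ∀ {m k} → Matrix m k → Set
ZeroOne D = ∀ i j → D i j ≡ 0ℤ ⊎ D i j ≡ 1ℤ

OneNonzeroPerColumn : ∀ {m k} → Matrix m k → Set
OneNonzeroPerColumn D =
  ∀ j → ∃[ i ] (D i j ≢ 0ℤ × (∀ i' → D i' j ≢ 0ℤ → i' ≡ i))

identityMatrix : (k : ℕ) → Matrix k k
identityMatrix k i j with i Fin.≟ j
... | Relation.Nullary.yes _ = 1ℤ
... | Relation.Nullary.no _ = 0ℤ

data 𝒟 (k : ℕ) : Set where
  identity : 𝒟 k
  divided  : (m : ℕ) → 1 ℕ.≤ m → m ℕ.≤ k ∸ 1 →
             (ν : Fin m → Fin k) (μ : Fin (k ∸ m) → Fin k) →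
             IsDivision k m ν μ →
             (D : Matrix m k) →
             Admissible k m 1ℤ ν μ D → ZeroOne D → OneNonzeroPerColumn D →
             𝒟 k

rows : ∀ {k} → 𝒟 k → ℕ
rows {k} identity = k
rows (divided m _ _ _ _ _ _ _ _ _) = m

nuOf : ∀ {k} (d : 𝒟 k) → Fin (rows d) → Fin k
nuOf identity i = i
nuOf (divided _ _ _ ν _ _ _ _ _ _) = ν

matOf : ∀ {k} (d : 𝒟 k) → Matrix (rows d) k
matOf {k} identity = identityMatrix k
matOf (divided _ _ _ _ _ _ D _ _ _) = D

-- Equality of elements of 𝒟(k): same matrix and same division
-- (proof components are irrelevant).
_≈𝒟_ : ∀ {k} → 𝒟 k → 𝒟 k → Set
identity ≈𝒟 identity = ⊤
identity ≈𝒟 divided _ _ _ _ _ _ _ _ _ _ = ⊥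
divided _ _ _ _ _ _ _ _ _ _ ≈𝒟 identity = ⊥
_≈𝒟_ {k} (divided m _ _ ν μ _ D _ _ _) (divided m' _ _ ν' μ' _ D' _ _ _) =
  (m ≡ m') ×
  (∀ (i : Fin m) (i' : Fin m') → toℕ i ≡ toℕ i' →
     ν i ≡ ν' i' × (∀ j → D i j ≡ D' i' j)) ×
  (∀ (j : Fin (k ∸ m)) (j' : Fin (k ∸ m')) → toℕ j ≡ toℕ j' → μ j ≡ μ' j')

-- A partition is given by a list of blocks (subsets of Fin k), each
-- nonempty, such that every element lies in exactly one listed block
-- (so the blocks are pairwise disjoint, cover, and are listed without
-- repetition).
record Partition (k : ℕ) : Set where
  field
    blocks   : List (Subset k)
    nonempty : ∀ (b : Fin (length blocks)) → Nonempty (lookup blocks b)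
    exactly  : ∀ (x : Fin k) →
               ∃[ b ] (x ∈ₛ lookup blocks b ×
                       (∀ b' → x ∈ₛ lookup blocks b' → b' ≡ b))
open Partition public

#_ : ∀ {k} → Partition k → ℕ
# P = length (blocks P)

_≈𝒫_ : ∀ {k} → Partition k → Partition k → Set
P ≈𝒫 P' = ∀ B → (B ∈ blocks P) ⇔ (B ∈ blocks P')

IsMinOf : ∀ {k} → Fin k → Subset k → Set
IsMinOf x B = x ∈ₛ B × (∀ y → y ∈ₛ B → x Fin.≤ y)

{-# OPTIONS --safe #-}
module Submission where

-- The bijection sends an element of 𝒟(k) to the partition into the supports
-- of its rows (singletons for I_k).  Admissibility with q = 1 says exactly
-- that ν_i is the least element of the support of row i, and a 0/1 matrix
-- with one non-zero entry per column is determined by its row supports.  So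
-- the matrix is recovered from the partition: ν enumerates the block minima
-- increasingly, μ the other elements, and D is the incidence matrix of the
-- blocks; I_k arises exactly when every block is a singleton.

open import Data.Nat as ℕ using (ℕ; zero; suc; _∸_; z≤n; s≤s; _≤_)
import Data.Nat.Properties as ℕ
open import Data.Fin as Fin using (Fin; toℕ; cast; inject₁)
import Data.Fin.Properties as Fin
open import Data.Fin.Induction using (<-weakInduction)
open import Data.Fin.Subset using (Subset; Nonempty; ⁅_⁆; ∁; ∣_∣; inside; outside)
  renaming (_∈_ to _∈ₛ_; _∉_ to _∉ₛ_)
open import Data.Fin.Subset.Properties
  using (x∈⁅x⁆; x∈⁅y⁆⇒x≡y; ⊆-antisym; _∈?_; ∣∁p∣≡n∸∣p∣; x∈∁p⇒x∉p; x∉p⇒x∈∁p; ∣p∣≡n⇒p≡⊤; ∣p∣≤n; ∈⊤)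
open import Data.Vec as Vec using (_∷_; here; there)
import Data.Vec.Properties as Vec
open import Data.Product using (Σ; ∃-syntax; _×_; _,_; proj₁; proj₂)
open import Data.Sum using (_⊎_; inj₁; inj₂)
open import Data.Empty using (⊥-elim)
open import Data.Unit using (tt)
open import Data.List as List using (length; lookup)
import Data.List.Properties as List
open import Data.Integer as ℤ using (ℤ; 0ℤ; 1ℤ)
open import Data.Integer.Divisibility using (_∣_)
open import Data.List.Membership.Propositional using (_∈_)
open import Data.List.Membership.Propositional.Properties using (∈-tabulate⁺; ∈-tabulate⁻; ∈-lookup)
import Data.List.Relation.Unary.Any as Any
open import Data.List.Relation.Unary.Any.Properties using (lookup-index)
open import Function.Base using (_∘_; id)
open import Function.Bundles using (_⇔_; mk⇔; Equivalence)
open import Function.Properties.Equivalence using () renaming (sym to ⇔-sym)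
open import Relation.Nullary using (¬_; Dec; yes; no; does)
open import Relation.Nullary.Decidable using (dec-true; ¬?; decidable-stable)
open import Relation.Unary using (Pred; Decidable)
open import Relation.Binary.PropositionalEquality
open import Relation.Binary.Definitions using (tri<; tri≈; tri>)
open import Defs

module _ {a k} {s : Fin a → Fin k} (s-incr : StrictlyIncreasing s) where

  strictlyIncreasing-injective : ∀ i j → s i ≡ s j → i ≡ j
  strictlyIncreasing-injective i j si≡sj with Fin.<-cmp i j
  ... | tri< i<j _ _ = ⊥-elim (ℕ.<⇒≢ (s-incr i j i<j) (cong toℕ si≡sj))
  ... | tri≈ _ i≡j _ = i≡j
  ... | tri> _ _ j<i = ⊥-elim (ℕ.<⇒≢ (s-incr j i j<i) (cong toℕ (sym si≡sj)))

  strictlyIncreasing-reflects-< : ∀ i j → s i Fin.< s j → i Fin.< j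
  strictlyIncreasing-reflects-< i j si<sj with Fin.<-cmp i j
  ... | tri< i<j _ _ = i<j
  ... | tri≈ _ refl _ = ⊥-elim (ℕ.<-irrefl refl si<sj)
  ... | tri> _ _ j<i = ⊥-elim (ℕ.<-asym si<sj (s-incr j i j<i))

toℕ≤toℕ-strictlyIncreasing : ∀ {a k} {s : Fin a → Fin k} → StrictlyIncreasing s →
                              ∀ i → toℕ i ≤ toℕ (s i)
toℕ≤toℕ-strictlyIncreasing {suc a} {s = s} s-incr = <-weakInduction (λ i → toℕ i ≤ toℕ (s i)) z≤n step
  where
  step : ∀ i → toℕ (inject₁ i) ≤ toℕ (s (inject₁ i)) → toℕ (Fin.suc i) ≤ toℕ (s (Fin.suc i))
  step i ih = ℕ.≤-<-trans (subst (_≤ toℕ (s (inject₁ i))) (Fin.toℕ-inject₁ i) ih)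
                          (s-incr (inject₁ i) (Fin.suc i) (Fin.≤̄⇒inject₁< Fin.≤-refl))

-- Each map factors through the other by a strictly increasing φ, and
-- i ≤ φ i ≤ φ⁻¹ (φ i) = i.
strictlyIncreasing-unique :
  ∀ {a b k} (s : Fin a → Fin k) (t : Fin b → Fin k) →
  StrictlyIncreasing s → StrictlyIncreasing t →
  (∀ i → ∃[ j ] t j ≡ s i) → (∀ j → ∃[ i ] s i ≡ t j) →
  (a ≡ b) × (∀ i j → toℕ i ≡ toℕ j → s i ≡ t j)
strictlyIncreasing-unique s t s-incr t-incr s⊆t t⊆s =
  ℕ.≤-antisym (Fin.injective⇒≤ (λ {i} {j} → strictlyIncreasing-injective φ-incr i j))
              (Fin.injective⇒≤ (λ {i} {j} → strictlyIncreasing-injective ψ-incr i j)) ,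
  λ i j i≡j → trans (sym (proj₂ (s⊆t i))) (cong t (Fin.toℕ-injective (trans (toℕ-φ i) i≡j)))
  where
  φ = λ i → proj₁ (s⊆t i)
  ψ = λ j → proj₁ (t⊆s j)
  φ-incr : StrictlyIncreasing φ
  φ-incr i i' i<i' = strictlyIncreasing-reflects-< t-incr (φ i) (φ i')
    (subst₂ Fin._<_ (sym (proj₂ (s⊆t i))) (sym (proj₂ (s⊆t i'))) (s-incr i i' i<i'))
  ψ-incr : StrictlyIncreasing ψ
  ψ-incr j j' j<j' = strictlyIncreasing-reflects-< s-incr (ψ j) (ψ j')
    (subst₂ Fin._<_ (sym (proj₂ (t⊆s j))) (sym (proj₂ (t⊆s j'))) (t-incr j j' j<j'))
  ψ∘φ : ∀ i → ψ (φ i) ≡ i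
  ψ∘φ i = strictlyIncreasing-injective s-incr _ _ (trans (proj₂ (t⊆s (φ i))) (proj₂ (s⊆t i)))
  toℕ-φ : ∀ i → toℕ (φ i) ≡ toℕ i
  toℕ-φ i = ℕ.≤-antisym (subst (λ i' → toℕ (φ i) ≤ toℕ i') (ψ∘φ i) (toℕ≤toℕ-strictlyIncreasing ψ-incr (φ i)))
                        (toℕ≤toℕ-strictlyIncreasing φ-incr i)

enumerate : ∀ {k} (S : Subset k) → Fin ∣ S ∣ → Fin k
enumerate (inside ∷ S) Fin.zero = Fin.zero
enumerate (inside ∷ S) (Fin.suc i) = Fin.suc (enumerate S i)
enumerate (outside ∷ S) i = Fin.suc (enumerate S i)

enumerate-strictlyIncreasing : ∀ {k} (S : Subset k) → StrictlyIncreasing (enumerate S)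
enumerate-strictlyIncreasing (inside ∷ S) Fin.zero (Fin.suc j) _ = s≤s z≤n
enumerate-strictlyIncreasing (inside ∷ S) (Fin.suc i) (Fin.suc j) (s≤s i<j) =
  s≤s (enumerate-strictlyIncreasing S i j i<j)
enumerate-strictlyIncreasing (outside ∷ S) i j i<j = s≤s (enumerate-strictlyIncreasing S i j i<j)

enumerate-∈ : ∀ {k} (S : Subset k) i → enumerate S i ∈ₛ S
enumerate-∈ (inside ∷ S) Fin.zero = here
enumerate-∈ (inside ∷ S) (Fin.suc i) = there (enumerate-∈ S i)
enumerate-∈ (outside ∷ S) i = there (enumerate-∈ S i)

enumerate-surjective : ∀ {k} {S : Subset k} {x} → x ∈ₛ S → ∃[ i ] enumerate S i ≡ x
enumerate-surjective {S = inside ∷ S} here = Fin.zero , refl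
enumerate-surjective {S = inside ∷ S} (there x∈S) with enumerate-surjective x∈S
... | i , refl = Fin.suc i , refl
enumerate-surjective {S = outside ∷ S} (there x∈S) with enumerate-surjective x∈S
... | i , refl = i , refl

enumerateComplement : ∀ {k} (S : Subset k) → Fin (k ∸ ∣ S ∣) → Fin k
enumerateComplement S = enumerate (∁ S) ∘ cast (sym (∣∁p∣≡n∸∣p∣ S))

enumerate-isDivision : ∀ {k} (S : Subset k) →
                       IsDivision k ∣ S ∣ (enumerate S) (enumerateComplement S)
enumerate-isDivision S =
  enumerate-strictlyIncreasing S , complement-incr ,
  (λ i j e → x∈∁p⇒x∉p (enumerate-∈ (∁ S) _) (subst (_∈ₛ S) e (enumerate-∈ S i))) ,
  cover
  where
  e = sym (∣∁p∣≡n∸∣p∣ S)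
  complement-incr : StrictlyIncreasing (enumerateComplement S)
  complement-incr i j i<j = enumerate-strictlyIncreasing (∁ S) (cast e i) (cast e j)
    (subst₂ ℕ._<_ (sym (Fin.toℕ-cast e i)) (sym (Fin.toℕ-cast e j)) i<j)
  cover : ∀ x → (∃[ i ] enumerate S i ≡ x) ⊎ (∃[ j ] enumerateComplement S j ≡ x)
  cover x with x ∈? S
  ... | yes x∈S = inj₁ (enumerate-surjective x∈S)
  ... | no x∉S with enumerate-surjective (x∉p⇒x∈∁p x∉S)
  ...   | j , refl = inj₂ (cast (sym e) j , cong (enumerate (∁ S)) (Fin.cast-involutive e (sym e) j))

subset : ∀ {k ℓ} {P : Pred (Fin k) ℓ} → Decidable P → Subset k
subset P? = Vec.tabulate (does ∘ P?)

module _ {k ℓ} {P : Pred (Fin k) ℓ} (P? : Decidable P) where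

  ∈-subset⁺ : ∀ {x} → P x → x ∈ₛ subset P?
  ∈-subset⁺ {x} px = Vec.lookup⇒[]= x _ (trans (Vec.lookup∘tabulate (does ∘ P?) x) (dec-true (P? x) px))

  ∈-subset⁻ : ∀ {x} → x ∈ₛ subset P? → P x
  ∈-subset⁻ {x} x∈ = witness (P? x) (trans (sym (Vec.lookup∘tabulate (does ∘ P?) x)) (Vec.[]=⇒lookup x∈))
    where
    witness : (d : Dec (P x)) → does d ≡ inside → P x
    witness (yes px) _ = px

isMinOf-unique : ∀ {k} {x y : Fin k} {B} → IsMinOf x B → IsMinOf y B → x ≡ y
isMinOf-unique (x∈B , x-min) (y∈B , y-min) = Fin.≤-antisym (x-min _ y∈B) (y-min _ x∈B)

minimum : ∀ {k} (B : Subset k) → Nonempty B → ∃[ x ] IsMinOf x B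
minimum {k} B (y , y∈B) with Fin.¬∀⟶∃¬-smallest k (_∉ₛ B) (λ x → ¬? (x ∈? B)) (λ ∉B → ∉B y y∈B)
... | x , ¬x∉B , below = x , decidable-stable (x ∈? B) ¬x∉B , x-min
  where
  x-min : ∀ z → z ∈ₛ B → x Fin.≤ z
  x-min z z∈B = ℕ.≮⇒≥ λ z<x → below (Fin.fromℕ< z<x)
    (subst (_∈ₛ B) (Fin.toℕ-injective (sym (trans (Fin.toℕ-inject _) (Fin.toℕ-fromℕ< z<x)))) z∈B)

module _ {k m} (f : Fin m → Subset k) where

  private
    length-f : length (List.tabulate f) ≡ m
    length-f = List.length-tabulate f

    lookup-tabulate : ∀ b → lookup (List.tabulate f) b ≡ f (cast length-f b)
    lookup-tabulate b = begin
      lookup fs b                                        ≡⟨ cong (lookup fs) (Fin.cast-involutive (sym length-f) length-f b) ⟨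
      lookup fs (cast (sym length-f) (cast length-f b))  ≡⟨ List.lookup-tabulate f (cast length-f b) ⟩
      f (cast length-f b)                                ∎
      where
      open ≡-Reasoning
      fs = List.tabulate f

  fromBlocks : (∀ i → Nonempty (f i)) →
               (∀ x → ∃[ i ] (x ∈ₛ f i × (∀ i' → x ∈ₛ f i' → i' ≡ i))) → Partition k
  fromBlocks nonempty exactly = record
    { blocks   = List.tabulate f
    ; nonempty = λ b → subst Nonempty (sym (lookup-tabulate b)) (nonempty (cast length-f b))
    ; exactly  = λ x → let (i , x∈fi , unique) = exactly x in
        cast (sym length-f) i ,
        subst (x ∈ₛ_) (sym (List.lookup-tabulate f i)) x∈fi ,
        λ b x∈b → trans (sym (Fin.cast-involutive (sym length-f) length-f b))
                        (cong (cast (sym length-f)) (unique _ (subst (x ∈ₛ_) (lookup-tabulate b) x∈b)))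
    }

1≢0 : 1ℤ ≢ 0ℤ
1≢0 ()

support : ∀ {m k} → Matrix m k → Fin m → Subset k
support D i = subset (λ j → ¬? (D i j ℤ.≟ 0ℤ))

module _ {m k} (D : Matrix m k) (i : Fin m) where

  ∈-support⁺ : ∀ {j} → D i j ≢ 0ℤ → j ∈ₛ support D i
  ∈-support⁺ = ∈-subset⁺ (λ j → ¬? (D i j ℤ.≟ 0ℤ))

  ∈-support⁻ : ∀ {j} → j ∈ₛ support D i → D i j ≢ 0ℤ
  ∈-support⁻ = ∈-subset⁻ (λ j → ¬? (D i j ℤ.≟ 0ℤ))

support-cong : ∀ {m m' k} (D : Matrix m k) (D' : Matrix m' k) {i i'} →
               (∀ j → D i j ≡ D' i' j) → support D i ≡ support D' i'
support-cong D D' D≡D' = Vec.tabulate-cong λ j → cong (λ z → does (¬? (z ℤ.≟ 0ℤ))) (D≡D' j)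

indicator : ∀ {a} {A : Set a} → Dec A → ℤ
indicator (yes _) = 1ℤ
indicator (no _) = 0ℤ

module _ {a} {A : Set a} where

  indicator-yes : (A? : Dec A) → A → indicator A? ≡ 1ℤ
  indicator-yes (yes _) _ = refl
  indicator-yes (no ¬a) a = ⊥-elim (¬a a)

  indicator-no : (A? : Dec A) → ¬ A → indicator A? ≡ 0ℤ
  indicator-no (yes a) ¬a = ⊥-elim (¬a a)
  indicator-no (no _) _ = refl

  indicator≢0 : (A? : Dec A) → indicator A? ≢ 0ℤ → A
  indicator≢0 (yes a) _ = a
  indicator≢0 (no _) 0≢0 = ⊥-elim (0≢0 refl)

  indicator-zeroOne : (A? : Dec A) → indicator A? ≡ 0ℤ ⊎ indicator A? ≡ 1ℤ
  indicator-zeroOne (yes _) = inj₂ refl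
  indicator-zeroOne (no _) = inj₁ refl

incidenceMatrix : ∀ {m k} → (Fin m → Subset k) → Matrix m k
incidenceMatrix B i j = indicator (j ∈? B i)

support-incidenceMatrix : ∀ {m k} (B : Fin m → Subset k) i → support (incidenceMatrix B) i ≡ B i
support-incidenceMatrix B i = ⊆-antisym
  (λ {j} j∈ → indicator≢0 (j ∈? B i) (∈-support⁻ (incidenceMatrix B) i j∈))
  (λ {j} j∈ → ∈-support⁺ (incidenceMatrix B) i λ 1≡0 → 1≢0 (trans (sym (indicator-yes (j ∈? B i) j∈)) 1≡0))

zeroOne-≡ : ∀ {z w} → z ≡ 0ℤ ⊎ z ≡ 1ℤ → w ≡ 0ℤ ⊎ w ≡ 1ℤ →
            (z ≢ 0ℤ → w ≢ 0ℤ) → (w ≢ 0ℤ → z ≢ 0ℤ) → z ≡ w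
zeroOne-≡ (inj₁ refl) (inj₁ refl) _ _ = refl
zeroOne-≡ (inj₁ refl) (inj₂ refl) _ w≢0→z≢0 = ⊥-elim (w≢0→z≢0 (λ ()) refl)
zeroOne-≡ (inj₂ refl) (inj₁ refl) z≢0→w≢0 _ = ⊥-elim (z≢0→w≢0 (λ ()) refl)
zeroOne-≡ (inj₂ refl) (inj₂ refl) _ _ = refl

zeroOne-support-injective : ∀ {m m' k} {D : Matrix m k} {D' : Matrix m' k} → ZeroOne D → ZeroOne D' →
                            ∀ {i i'} → support D i ≡ support D' i' → ∀ j → D i j ≡ D' i' j
zeroOne-support-injective {D = D} {D'} zeroOne zeroOne' {i} {i'} same-support j =
  zeroOne-≡ (zeroOne i j) (zeroOne' i' j)
    (λ Dij≢0 → ∈-support⁻ D' i' (subst (j ∈ₛ_) same-support (∈-support⁺ D i Dij≢0)))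
    (λ D'i'j≢0 → ∈-support⁻ D i (subst (j ∈ₛ_) (sym same-support) (∈-support⁺ D' i' D'i'j≢0)))

row : ∀ {k} (d : 𝒟 k) → Fin (rows d) → Subset k
row identity i = ⁅ i ⁆
row (divided _ _ _ _ _ _ D _ _ _) = support D

nuOf-isMinOf-row : ∀ {k} (d : 𝒟 k) i → IsMinOf (nuOf d i) (row d i)
nuOf-isMinOf-row identity i = x∈⁅x⁆ i , λ y y∈⁅i⁆ → Fin.≤-reflexive (sym (x∈⁅y⁆⇒x≡y i y∈⁅i⁆))
nuOf-isMinOf-row (divided _ _ _ ν μ (_ , _ , _ , cover) D (_ , _ , diagonal , lower) _ _) i =
  ∈-support⁺ D i νᵢ-nonzero , ν-min
  where
  νᵢ-nonzero : D i (ν i) ≢ 0ℤ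
  νᵢ-nonzero Diνi≡0 = 1≢0 (trans (sym (proj₁ (diagonal i i) refl)) Diνi≡0)
  ν-min : ∀ y → y ∈ₛ support D i → ν i Fin.≤ y
  ν-min y y∈row with cover y
  ... | inj₁ (l , refl) with i Fin.≟ l
  ...   | yes refl = Fin.≤-refl
  ...   | no i≢l = ⊥-elim (∈-support⁻ D i y∈row (proj₂ (diagonal i l) i≢l))
  ν-min y y∈row | inj₂ (l , refl) with μ l Fin.<? ν i
  ...   | yes μl<νi = ⊥-elim (∈-support⁻ D i y∈row (lower i l μl<νi))
  ...   | no μl≮νi = ℕ.≮⇒≥ μl≮νi

row-exactly : ∀ {k} (d : 𝒟 k) x → ∃[ i ] (x ∈ₛ row d i × (∀ i' → x ∈ₛ row d i' → i' ≡ i))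
row-exactly identity x = x , x∈⁅x⁆ x , λ i' x∈⁅i'⁆ → sym (x∈⁅y⁆⇒x≡y i' x∈⁅i'⁆)
row-exactly (divided _ _ _ _ _ _ D _ _ oneNonzero) x =
  let (i , Dix≢0 , unique) = oneNonzero x in
  i , ∈-support⁺ D i Dix≢0 , λ i' x∈row → unique i' (∈-support⁻ D i' x∈row)

partitionOf : ∀ {k} → 𝒟 k → Partition k
partitionOf d = fromBlocks (row d) (λ i → nuOf d i , proj₁ (nuOf-isMinOf-row d i)) (row-exactly d)

#-partitionOf : ∀ {k} (d : 𝒟 k) → # partitionOf d ≡ rows d
#-partitionOf d = List.length-tabulate (row d)

nuOf⇔isMinOf-block : ∀ {k} (d : 𝒟 k) x →
  (∃[ i ] nuOf d i ≡ x) ⇔ (∃[ B ] (B ∈ blocks (partitionOf d) × IsMinOf x B))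
nuOf⇔isMinOf-block d x = mk⇔
  (λ { (i , refl) → row d i , ∈-tabulate⁺ i , nuOf-isMinOf-row d i })
  (λ { (B , B∈ , x-min) → let (i , B≡rowᵢ) = ∈-tabulate⁻ B∈ in
       i , isMinOf-unique (nuOf-isMinOf-row d i) (subst (IsMinOf x) B≡rowᵢ x-min) })

partitionOf-cong : ∀ {k} (d d' : 𝒟 k) → d ≈𝒟 d' → partitionOf d ≈𝒫 partitionOf d'
partitionOf-cong identity identity _ B = mk⇔ id id
partitionOf-cong (divided m _ _ _ _ _ D _ _ _) (divided .m _ _ _ _ _ D' _ _ _) (refl , same-rows , _) B =
  mk⇔ (subst (B ∈_) rows≡) (subst (B ∈_) (sym rows≡))
  where
  rows≡ : List.tabulate (support D) ≡ List.tabulate (support D')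
  rows≡ = List.tabulate-cong λ i → support-cong D D' (proj₂ (same-rows i i refl))

matching-row : ∀ {k} (d d' : 𝒟 k) → partitionOf d ≈𝒫 partitionOf d' → ∀ i →
               ∃[ i' ] (row d i ≡ row d' i' × nuOf d i ≡ nuOf d' i')
matching-row d d' d≈d' i =
  let (i' , rowᵢ≡rowᵢ') = ∈-tabulate⁻ (Equivalence.to (d≈d' (row d i)) (∈-tabulate⁺ i)) in
  i' , rowᵢ≡rowᵢ' ,
  isMinOf-unique (nuOf-isMinOf-row d i) (subst (IsMinOf _) (sym rowᵢ≡rowᵢ') (nuOf-isMinOf-row d' i'))

complement-image : ∀ {k m m'} {ν : Fin m → Fin k} {μ : Fin (k ∸ m) → Fin k}
                   {ν' : Fin m' → Fin k} {μ' : Fin (k ∸ m') → Fin k} →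
                   IsDivision k m ν μ → IsDivision k m' ν' μ' →
                   (∀ i' → ∃[ i ] ν i ≡ ν' i') → ∀ j → ∃[ j' ] μ' j' ≡ μ j
complement-image {μ = μ} (_ , _ , disjoint , _) (_ , _ , _ , cover') ν'⊆ν j with cover' (μ j)
... | inj₂ μj∈μ' = μj∈μ'
... | inj₁ (i' , ν'i'≡μj) = let (i , νi≡ν'i') = ν'⊆ν i' in ⊥-elim (disjoint i j (trans νi≡ν'i' ν'i'≡μj))

complement-index : ∀ {k m} → 1 ≤ m → m ≤ k ∸ 1 → Fin (k ∸ m)
complement-index {zero} (s≤s _) ()
complement-index {suc k} _ m≤k = Fin.fromℕ< (ℕ.m<n⇒0<n∸m (s≤s m≤k))

partitionOf-identity-injective : ∀ {k} (d : 𝒟 k) → partitionOf identity ≈𝒫 partitionOf d → identity ≈𝒟 d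
partitionOf-identity-injective identity _ = tt
partitionOf-identity-injective d@(divided _ 1≤m m≤k-1 _ μ (_ , _ , disjoint , _) _ _ _ _) id≈d =
  let j = complement-index 1≤m m≤k-1
      (i , _ , μj≡νi) = matching-row identity d id≈d (μ j)
  in disjoint i j (sym μj≡νi)

partitionOf-injective : ∀ {k} (d d' : 𝒟 k) → partitionOf d ≈𝒫 partitionOf d' → d ≈𝒟 d'
partitionOf-injective identity d' d≈d' = partitionOf-identity-injective d' d≈d'
partitionOf-injective d@(divided _ _ _ _ _ _ _ _ _ _) identity d≈d' =
  partitionOf-identity-injective d (⇔-sym ∘ d≈d')
partitionOf-injective
  d@(divided m _ _ ν μ division@(ν-incr , μ-incr , _) D _ zeroOne _)
  d'@(divided m' _ _ ν' μ' division'@(ν'-incr , μ'-incr , _) D' _ zeroOne' _) d≈d' =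
  m≡m' , same-rows , proj₂ same-μ
  where
  ν⊆ν' : ∀ i → ∃[ i' ] ν' i' ≡ ν i
  ν⊆ν' i = let (i' , _ , νi≡ν'i') = matching-row d d' d≈d' i in i' , sym νi≡ν'i'
  ν'⊆ν : ∀ i' → ∃[ i ] ν i ≡ ν' i'
  ν'⊆ν i' = let (i , _ , ν'i'≡νi) = matching-row d' d (⇔-sym ∘ d≈d') i' in i , sym ν'i'≡νi
  same-ν = strictlyIncreasing-unique ν ν' ν-incr ν'-incr ν⊆ν' ν'⊆ν
  m≡m' = proj₁ same-ν
  same-μ = strictlyIncreasing-unique μ μ' μ-incr μ'-incr
             (complement-image division division' ν'⊆ν) (complement-image division' division ν⊆ν')
  same-rows : ∀ i i' → toℕ i ≡ toℕ i' → ν i ≡ ν' i' × (∀ j → D i j ≡ D' i' j)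
  same-rows i i' i≡i' with matching-row d d' d≈d' i
  ... | i'' , rowᵢ≡rowᵢ'' , νi≡ν'i'' =
    νi≡ν'i' , zeroOne-support-injective zeroOne zeroOne' (trans rowᵢ≡rowᵢ'' (cong (support D') i''≡i'))
    where
    νi≡ν'i' = proj₂ same-ν i i' i≡i'
    i''≡i' : i'' ≡ i'
    i''≡i' = strictlyIncreasing-injective ν'-incr i'' i' (trans (sym νi≡ν'i'') νi≡ν'i')


module Leaders {k} (P : Partition k) where

  block : Fin (# P) → Subset k
  block = lookup (blocks P)

  blockOf : Fin k → Fin (# P)
  blockOf x = proj₁ (exactly P x)

  ∈-blockOf : ∀ x → x ∈ₛ block (blockOf x)
  ∈-blockOf x = proj₁ (proj₂ (exactly P x))

  blockOf-unique : ∀ {x b} → x ∈ₛ block b → blockOf x ≡ b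
  blockOf-unique {x} {b} x∈b = sym (proj₂ (proj₂ (exactly P x)) b x∈b)

  leader : Fin (# P) → Fin k
  leader b = proj₁ (minimum (block b) (nonempty P b))

  leader-isMinOf : ∀ b → IsMinOf (leader b) (block b)
  leader-isMinOf b = proj₂ (minimum (block b) (nonempty P b))

  IsLeader : Fin k → Set
  IsLeader x = leader (blockOf x) ≡ x

  blockOf-leader : ∀ b → blockOf (leader b) ≡ b
  blockOf-leader b = blockOf-unique (proj₁ (leader-isMinOf b))

  leader-isLeader : ∀ b → IsLeader (leader b)
  leader-isLeader b = cong leader (blockOf-leader b)

  leader-unique : ∀ {x y} → IsLeader x → y ∈ₛ block (blockOf x) → leader (blockOf y) ≡ x
  leader-unique {x} x-leader y∈ = trans (cong leader (blockOf-unique y∈)) x-leader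

  isLeader? : Decidable IsLeader
  isLeader? x = leader (blockOf x) Fin.≟ x

  leaders : Subset k
  leaders = subset isLeader?

  ν : Fin ∣ leaders ∣ → Fin k
  ν = enumerate leaders

  ν-isLeader : ∀ i → IsLeader (ν i)
  ν-isLeader i = ∈-subset⁻ isLeader? (enumerate-∈ leaders i)

  ν-surjective : ∀ {x} → IsLeader x → ∃[ i ] ν i ≡ x
  ν-surjective x-leader = enumerate-surjective (∈-subset⁺ isLeader? x-leader)

  partitionOf-≈𝒫 : (d : 𝒟 k) → (∀ {x} → IsLeader x → ∃[ i ] nuOf d i ≡ x) →
                   (∀ i → row d i ≡ block (blockOf (nuOf d i))) → partitionOf d ≈𝒫 P
  partitionOf-≈𝒫 d nuOf-surjective row≡block B = mk⇔ to from
    where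
    to : B ∈ blocks (partitionOf d) → B ∈ blocks P
    to B∈ = let (i , B≡rowᵢ) = ∈-tabulate⁻ B∈ in
      subst (_∈ blocks P) (sym (trans B≡rowᵢ (row≡block i))) (∈-lookup (blockOf (nuOf d i)))
    from : B ∈ blocks P → B ∈ blocks (partitionOf d)
    from B∈ = subst (_∈ blocks (partitionOf d)) B≡rowᵢ (∈-tabulate⁺ i)
      where
      b = Any.index B∈
      i = proj₁ (nuOf-surjective (leader-isLeader b))
      B≡rowᵢ : row d i ≡ B
      B≡rowᵢ = begin
        row d i                          ≡⟨ row≡block i ⟩
        block (blockOf (nuOf d i))       ≡⟨ cong (block ∘ blockOf) (proj₂ (nuOf-surjective (leader-isLeader b))) ⟩
        block (blockOf (leader b))       ≡⟨ cong block (blockOf-leader b) ⟩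
        block b                          ≡⟨ lookup-index B∈ ⟨
        B                                ∎
        where open ≡-Reasoning

  all-leaders-realised : ∣ leaders ∣ ≡ k → partitionOf identity ≈𝒫 P
  all-leaders-realised ∣leaders∣≡k = partitionOf-≈𝒫 identity (λ {x} _ → x , refl) singleton-blocks
    where
    all-leaders : ∀ x → IsLeader x
    all-leaders x = ∈-subset⁻ isLeader? (subst (x ∈ₛ_) (sym (∣p∣≡n⇒p≡⊤ ∣leaders∣≡k)) ∈⊤)
    singleton-blocks : ∀ i → ⁅ i ⁆ ≡ block (blockOf i)
    singleton-blocks i = ⊆-antisym
      (λ {y} y∈⁅i⁆ → subst (_∈ₛ block (blockOf i)) (sym (x∈⁅y⁆⇒x≡y i y∈⁅i⁆)) (∈-blockOf i))
      (λ {y} y∈ → subst (_∈ₛ ⁅ i ⁆) (trans (sym (leader-unique (all-leaders i) y∈)) (all-leaders y)) (x∈⁅x⁆ i))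

  module SomeBlockNotSingleton (1≤k : 1 ≤ k) (∣leaders∣≢k : ∣ leaders ∣ ≢ k) where

    m : ℕ
    m = ∣ leaders ∣

    μ : Fin (k ∸ m) → Fin k
    μ = enumerateComplement leaders

    leaderBlock : Fin m → Subset k
    leaderBlock i = block (blockOf (ν i))

    D : Matrix m k
    D = incidenceMatrix leaderBlock

    leaderBlock-covers : ∀ j → ∃[ i ] j ∈ₛ leaderBlock i
    leaderBlock-covers j =
      let (i , νi≡leader) = ν-surjective (leader-isLeader (blockOf j))
          same-block = trans (cong blockOf νi≡leader) (blockOf-leader (blockOf j))
      in i , subst (λ b → j ∈ₛ block b) (sym same-block) (∈-blockOf j)

    leaderBlock-disjoint : ∀ {i i' j} → j ∈ₛ leaderBlock i → j ∈ₛ leaderBlock i' → i ≡ i'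
    leaderBlock-disjoint {i} {i'} j∈ j∈' = strictlyIncreasing-injective (enumerate-strictlyIncreasing leaders) i i'
      (trans (sym (leader-unique (ν-isLeader i) j∈)) (leader-unique (ν-isLeader i') j∈'))

    D-one : ∀ {i j} → j ∈ₛ leaderBlock i → D i j ≡ 1ℤ
    D-one {i} {j} = indicator-yes (j ∈? leaderBlock i)

    D-nonzero : ∀ {i j} → j ∈ₛ leaderBlock i → D i j ≢ 0ℤ
    D-nonzero j∈ Dij≡0 = 1≢0 (trans (sym (D-one j∈)) Dij≡0)

    D-zero : ∀ {i j} → j ∉ₛ leaderBlock i → D i j ≡ 0ℤ
    D-zero {i} {j} = indicator-no (j ∈? leaderBlock i)

    1≤m : 1 ≤ m
    1≤m = ℕ.≤-trans (s≤s z≤n) (Fin.toℕ<n (proj₁ (leaderBlock-covers (Fin.fromℕ< 1≤k))))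

    m≤k-1 : m ≤ k ∸ 1
    m≤k-1 = ℕ.∸-monoˡ-≤ 1 (ℕ.≤∧≢⇒< (∣p∣≤n leaders) ∣leaders∣≢k)

    admissible : Admissible k m 1ℤ ν μ D
    admissible =
      (λ j → let (i , j∈) = leaderBlock-covers j in i , D-nonzero j∈) ,
      (λ c c∣D → let i = proj₁ (leaderBlock-covers (Fin.fromℕ< 1≤k)) in
                 subst (c ∣_) (D-one (∈-blockOf (ν i))) (c∣D i (ν i))) ,
      (λ i j → (λ { refl → D-one (∈-blockOf (ν i)) }) ,
               (λ i≢j → D-zero λ νj∈ → i≢j (leaderBlock-disjoint νj∈ (∈-blockOf (ν j))))) ,
      λ i j μj<νi → D-zero λ μj∈ → ℕ.<⇒≱ μj<νi (νᵢ-min i μj∈)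
      where
      νᵢ-min : ∀ i {y} → y ∈ₛ leaderBlock i → ν i Fin.≤ y
      νᵢ-min i y∈ = subst (Fin._≤ _) (ν-isLeader i) (proj₂ (leader-isMinOf (blockOf (ν i))) _ y∈)

    oneNonzeroPerColumn : OneNonzeroPerColumn D
    oneNonzeroPerColumn j =
      let (i , j∈) = leaderBlock-covers j in
      i , D-nonzero j∈ , λ i' Di'j≢0 → leaderBlock-disjoint (indicator≢0 (j ∈? leaderBlock i') Di'j≢0) j∈

    d : 𝒟 k
    d = divided m 1≤m m≤k-1 ν μ (enumerate-isDivision leaders) D admissible
                (λ i j → indicator-zeroOne (j ∈? leaderBlock i)) oneNonzeroPerColumn

    realised : partitionOf d ≈𝒫 P
    realised = partitionOf-≈𝒫 d ν-surjective (support-incidenceMatrix leaderBlock)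

  partitionOf-surjective : 1 ≤ k → ∃[ d ] partitionOf d ≈𝒫 P
  partitionOf-surjective 1≤k with ∣ leaders ∣ ℕ.≟ k
  ... | yes ∣leaders∣≡k = identity , all-leaders-realised ∣leaders∣≡k
  ... | no ∣leaders∣≢k = d , realised
    where open SomeBlockNotSingleton 1≤k ∣leaders∣≢k

lemma3 : (k : ℕ) → 1 ≤ k →
    Σ (𝒟 k → Partition k) λ g →
      -- g is well defined on 𝒟(k)
      (∀ d d' → d ≈𝒟 d' → g d ≈𝒫 g d') ×
      -- injective
      (∀ d d' → g d ≈𝒫 g d' → d ≈𝒟 d') ×
      -- surjective
      (∀ P → ∃[ d ] g d ≈𝒫 P) ×
      -- #P = m and {ν_1,…,ν_m} = {j_B : B ∈ P}
      (∀ d → (# g d ≡ rows d) ×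
        (∀ (x : Fin k) →
          (∃[ i ] nuOf d i ≡ x) ⇔ (∃[ B ] (B ∈ blocks (g d) × IsMinOf x B))))
lemma3 k 1≤k =
  partitionOf ,
  partitionOf-cong ,
  partitionOf-injective ,
  (λ P → Leaders.partitionOf-surjective P 1≤k) ,
  λ d → #-partitionOf d , nuOf⇔isMinOf-block d
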